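{- Let $(X,\leq,g)$ be a Kleene--Varlet space, and consider the regular pseudocomplemented Kleene algebra $(\mathcal{U}(X),\cup,\cap,{\sim},{^*},\emptyset,X)$, where $\mathcal{U}(X)$ is the family of upward-closed subsets of $(X,\leq)$, ${\sim}A=\{x\in X\mid g(x)\notin A\}$ and $A^*=\{x\in X\mid {\uparrow}x\cap A=\emptyset\}$ with ${\uparrow}x=\{y\mid x\leq y\}$. This algebra satisfies the Stone identity $A^*\cup A^{**}=X$ for all $A\in\mathcal{U}(X)$ if and only if $(X,\leq)$ is a union of disjoint chains of at most two elements (i.e. $X$ can be partitioned into chains of at most two elements such that elements from different blocks are incomparable).
   Context: A Kleene--Varlet space is a triple $(X,\leq,g)$ where $(X,\leq)$ is a poset and $g\colon X\to X$ satisfies: (J1) $x\leq y$ implies $g(x)\geq g(y)$; (J2) $g(g(x))=x$; (J3) $x\leq g(x)$ or $g(x)\leq x$; (J4) every chain in $(X,\leq)$ has at most two elements. -}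

module Defs where

open import Level using (Level; _⊔_; suc)
open import Data.Product using (Σ; _×_; _,_; ∃)
open import Data.Sum using (_⊎_)
open import Data.Empty using (⊥)
open import Relation.Nullary using (¬_)
open import Relation.Binary.Bundles using (Poset)
open import Relation.Binary.Core using (Rel)
open import Relation.Binary.Structures using (IsEquivalence)
open import Relation.Unary using (Pred)

record KleeneVarletSpace (c ℓ₁ ℓ₂ : Level) : Set (suc (c ⊔ ℓ₁ ⊔ ℓ₂)) where
  field
    poset : Poset c ℓ₁ ℓ₂
  open Poset poset public
  field
    g       : Carrier → Carrier
    g-cong  : ∀ {x y} → x ≈ y → g x ≈ g y
    J1      : ∀ {x y} → x ≤ y → g y ≤ g x
    J2      : ∀ x → g (g x) ≈ x
    J3      : ∀ x → x ≤ g x ⊎ g x ≤ x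
    -- (J4) every chain has at most two elements: among any three
    -- pairwise comparable elements, two are equal
    J4      : ∀ x y z → (x ≤ y ⊎ y ≤ x) → (y ≤ z ⊎ z ≤ y) → (x ≤ z ⊎ z ≤ x)
              → x ≈ y ⊎ y ≈ z ⊎ x ≈ z

module _ {c ℓ₁ ℓ₂ : Level} (K : KleeneVarletSpace c ℓ₁ ℓ₂) where
  open KleeneVarletSpace K

  Lvl : Level
  Lvl = c ⊔ ℓ₁ ⊔ ℓ₂

  UpClosed : Pred Carrier Lvl → Set Lvl
  UpClosed A = ∀ {x y} → x ≤ y → A x → A y

  _* : Pred Carrier Lvl → Pred Carrier Lvl
  (A *) x = ∀ y → x ≤ y → ¬ A y

  -- Kleene negation  ∼A = { x | g x ∉ A }  (part of the algebra; not
  -- needed in the statement of the Stone identity)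
  ∼_ : Pred Carrier Lvl → Pred Carrier Lvl
  (∼ A) x = ¬ A (g x)

  StoneIdentity : Set (suc Lvl)
  StoneIdentity = (A : Pred Carrier Lvl) → UpClosed A →
                  ∀ x → (A *) x ⊎ ((A *) *) x

  -- (X, ≤) is a union of disjoint chains of at most two elements:
  -- there is a partition of X (given by an equivalence relation R whose
  -- classes are the blocks) such that each block is a chain with at most
  -- two elements and elements from different blocks are incomparable.
  DisjointUnionOfSmallChains : Set (suc Lvl)
  DisjointUnionOfSmallChains =
    Σ (Rel Carrier Lvl) λ R →
        IsEquivalence R
      × (∀ x y → R x y → x ≤ y ⊎ y ≤ x)
      × (∀ x y z → R x y → R x z → x ≈ y ⊎ y ≈ z ⊎ x ≈ z)
      × (∀ x y → ¬ R x y → ¬ (x ≤ y ⊎ y ≤ x))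

module Submission where

-- (⇒) The blocks are the classes of comparability.  It is reflexive and
-- symmetric; the Stone identity makes it transitive.  Applied to the
-- principal up-set ↑x at a common lower bound y of x and z, the identity
-- forces x and z to be comparable, because (by J4) any common upper
-- bound of x and z above y collapses a three-element chain.  The order
-- reversing involution g turns this into the dual statement for common
-- upper bounds, and the two together give transitivity.  Blocks are
-- chains by construction and have at most two elements by J4.
-- (⇐) If x ∉ A*, then for y ≥ x with y ∈ A* and w ≥ x with w ∈ A, the
-- elements x, y, w lie in one block of size ≤ 2, which yields w ≤ y,
-- contradicting y ∈ A*; hence x ∈ A**.  Excluded middle decides which
-- of the two alternatives of the identity holds, and decides
-- comparability in the forward direction.

open import Defs
open import Level using (_⊔_; Lift; lift; lower)
open import Axiom.ExcludedMiddle using (ExcludedMiddle)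
open import Function.Bundles using (_⇔_; mk⇔)
open import Data.Product using (_,_)
open import Data.Sum using (_⊎_; inj₁; inj₂)
open import Data.Empty using (⊥-elim)
open import Relation.Nullary using (¬_; yes; no)
open import Relation.Unary using (Pred)
open import Relation.Binary.Structures using (IsEquivalence)

module _ {c ℓ₁ ℓ₂} (K : KleeneVarletSpace c ℓ₁ ℓ₂) where
  open KleeneVarletSpace K

  private
    L = c ⊔ ℓ₁ ⊔ ℓ₂

  Comparable : Carrier → Carrier → Set ℓ₂
  Comparable x y = x ≤ y ⊎ y ≤ x

  comparable-sym : ∀ {x y} → Comparable x y → Comparable y x
  comparable-sym (inj₁ x≤y) = inj₂ x≤y
  comparable-sym (inj₂ y≤x) = inj₁ y≤x

  ≈⇒≥ : ∀ {x y} → x ≈ y → y ≤ x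
  ≈⇒≥ x≈y = reflexive (Eq.sym x≈y)

  ↑ : Carrier → Pred Carrier L
  ↑ x y = Lift L (x ≤ y)

  ↑-upClosed : ∀ x → UpClosed K (↑ x)
  ↑-upClosed x y≤z (lift x≤y) = lift (trans x≤y y≤z)

  *-upClosed : ∀ A → UpClosed K (_* K A)
  *-upClosed A x≤y a*x w y≤w = a*x w (trans x≤y y≤w)

  -- Consequence of J4: if y ≤ x ≤ w and y ≤ z ≤ w, then x and z are
  -- comparable, since the chain y ≤ x ≤ w has a repeated element.
  commonBounds⇒comparable : ∀ {x y z w} → y ≤ x → y ≤ z → x ≤ w → z ≤ w →
                            Comparable x z
  commonBounds⇒comparable {x} {y} {z} {w} y≤x y≤z x≤w z≤w
    with J4 y x w (inj₁ y≤x) (inj₁ x≤w) (inj₁ (trans y≤x x≤w))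
  ... | inj₁ y≈x        = inj₁ (trans (≈⇒≥ y≈x) y≤z)
  ... | inj₂ (inj₁ x≈w) = inj₂ (trans z≤w (≈⇒≥ x≈w))
  ... | inj₂ (inj₂ y≈w) = inj₁ (trans (trans x≤w (≈⇒≥ y≈w)) y≤z)

  g-reflects : ∀ {x y} → g x ≤ g y → y ≤ x
  g-reflects {x} {y} gx≤gy =
    trans (≈⇒≥ (J2 y)) (trans (J1 gx≤gy) (reflexive (J2 x)))

  module StoneComparability (em : ExcludedMiddle L) (stone : StoneIdentity K) where

    -- Elements with a common lower bound are comparable: apply the
    -- Stone identity to ↑x at the lower bound y.
    lowerBound⇒comparable : ∀ {x y z} → y ≤ x → y ≤ z → Comparable x z
    lowerBound⇒comparable {x} {y} {z} y≤x y≤z with em {Lift L (Comparable x z)}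
    ... | yes (lift x~z) = x~z
    ... | no x≁z with stone (↑ x) (↑-upClosed x) y
    ...   | inj₁ ↑x*y  = ⊥-elim (↑x*y x y≤x (lift refl))
    ...   | inj₂ ↑x**y = ⊥-elim (↑x**y z y≤z ↑x*z)
      where
        ↑x*z : _* K (↑ x) z
        ↑x*z w z≤w (lift x≤w) =
          x≁z (lift (commonBounds⇒comparable y≤x y≤z x≤w z≤w))

    upperBound⇒comparable : ∀ {x y z} → x ≤ y → z ≤ y → Comparable x z
    upperBound⇒comparable x≤y z≤y with lowerBound⇒comparable (J1 x≤y) (J1 z≤y)
    ... | inj₁ gx≤gz = inj₂ (g-reflects gx≤gz)
    ... | inj₂ gz≤gx = inj₁ (g-reflects gz≤gx)

    comparable-trans : ∀ {x y z} → Comparable x y → Comparable y z → Comparable x z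
    comparable-trans (inj₁ x≤y) (inj₁ y≤z) = inj₁ (trans x≤y y≤z)
    comparable-trans (inj₁ x≤y) (inj₂ z≤y) = upperBound⇒comparable x≤y z≤y
    comparable-trans (inj₂ y≤x) (inj₁ y≤z) = lowerBound⇒comparable y≤x y≤z
    comparable-trans (inj₂ y≤x) (inj₂ z≤y) = inj₂ (trans z≤y y≤x)

    SameBlock : Carrier → Carrier → Set L
    SameBlock x y = Lift L (Comparable x y)

    sameBlock-isEquivalence : IsEquivalence SameBlock
    sameBlock-isEquivalence = record
      { refl  = lift (inj₁ refl)
      ; sym   = λ (lift x~y) → lift (comparable-sym x~y)
      ; trans = λ (lift x~y) (lift y~z) → lift (comparable-trans x~y y~z)
      }

    comparabilityPartition : DisjointUnionOfSmallChains K
    comparabilityPartition =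
        SameBlock
      , sameBlock-isEquivalence
      , (λ x y → lower)
      , (λ x y z (lift x~y) (lift x~z) →
           J4 x y z x~y (comparable-trans (comparable-sym x~y) x~z) x~z)
      , (λ x y x≁y x~y → x≁y (lift x~y))

  partition⇒stone : ExcludedMiddle L → DisjointUnionOfSmallChains K → StoneIdentity K
  partition⇒stone em (R , _ , _ , small , separated) A upA x with em {_* K A x}
  ... | yes a*x = inj₁ a*x
  ... | no ¬a*x = inj₂ λ y x≤y a*y → ¬a*x λ w x≤w aw →
          sameBlock x≤y λ Rxy → sameBlock x≤w λ Rxw →
          a*y y refl (upA (below x≤y a*y (small x y w Rxy Rxw)) aw)
    where
      sameBlock : ∀ {u v} → u ≤ v → ¬ ¬ R u v
      sameBlock {u} {v} u≤v ¬Ruv = separated u v ¬Ruv (inj₁ u≤v)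

      -- In the two-element block of x, the element w lies below y; the
      -- case x ≈ y is impossible since then y ∈ A* would put x in A*.
      below : ∀ {y w} → x ≤ y → _* K A y → x ≈ y ⊎ y ≈ w ⊎ x ≈ w → w ≤ y
      below x≤y a*y (inj₁ x≈y) = ⊥-elim (¬a*x (*-upClosed A (≈⇒≥ x≈y) a*y))
      below x≤y a*y (inj₂ (inj₁ y≈w)) = ≈⇒≥ y≈w
      below x≤y a*y (inj₂ (inj₂ x≈w)) = trans (≈⇒≥ x≈w) x≤y

proposition5p1 : ∀ {c ℓ₁ ℓ₂} → ExcludedMiddle (c ⊔ ℓ₁ ⊔ ℓ₂) →
    (K : KleeneVarletSpace c ℓ₁ ℓ₂) →
    StoneIdentity K ⇔ DisjointUnionOfSmallChains K
proposition5p1 em K =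
  mk⇔ (λ stone → StoneComparability.comparabilityPartition K em stone)
      (partition⇒stone K em)
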